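{- Let $G$ be a connected $(P_3+P_2)$-free graph, $x,y$ adjacent vertices of $G$, $A_{xy}$ the set of vertices of $G-\{x,y\}$ adjacent to $x$ or $y$, $B_{xy}=V(G)\setminus(A_{xy}\cup\{x,y\})$, let $z\in A_{xy}$ have a neighbor in $B_{xy}$ with $B_{xy}\setminus N(z)$ independent, and let $H=G-(\{z\}\cup (N(z)\cap B_{xy}))$, $A=A_{xy}\setminus\{z\}$, $B=B_{xy}\setminus N(z)$. Assume that $H$ is connected, $A$ and $B$ are non-empty, every vertex of $A$ has a neighbor in $B$, no vertex of $B$ has degree one in $H$, and there are no two distinct vertices $u,v\in A$ with $N_H(u)\setminus(A\cup\{x,y\})\subseteq N_H(v)\setminus(A\cup\{x,y\})$. Then in $H$ every vertex of $N_H(x)\setminus(\{y\}\cup N_H(y))$ is adjacent to every vertex of $N_H(y)\setminus\{x\}$.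
   Context: $P_3+P_2$ is the disjoint union of a path on 3 vertices and a path on 2 vertices; "$H$-free" means having no induced subgraph isomorphic to $H$. $N(v)$, $N_H(v)$ denote open neighborhoods in $G$, resp. $H$. -}

module Defs where

open import Data.Nat using (ℕ)
open import Data.Fin using (Fin)
open import Data.Product using (Σ; ∃; _×_; _,_)
open import Data.Sum using (_⊎_)
open import Relation.Nullary using (¬_; Dec)
open import Relation.Binary.PropositionalEquality using (_≡_; _≢_)
open import Level using (0ℓ)

record Graph (n : ℕ) : Set₁ where
  field
    Adj     : Fin n → Fin n → Set
    sym     : ∀ {u v} → Adj u v → Adj v u
    irrefl  : ∀ {v} → ¬ Adj v v
    adj?    : ∀ u v → Dec (Adj u v)
open Graph public

VSet : ℕ → Set₁
VSet n = Fin n → Set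

data Walk {n : ℕ} (G : Graph n) (S : VSet n) : Fin n → Fin n → Set where
  here : ∀ {v} → S v → Walk G S v v
  step : ∀ {u v w} → S u → Adj G u v → Walk G S v w → Walk G S u w

ConnectedOn : {n : ℕ} → Graph n → VSet n → Set
ConnectedOn G S = ∀ u v → S u → S v → Walk G S u v

Everything : {n : ℕ} → VSet n
Everything _ = Data.Unit.⊤
  where import Data.Unit

Connected : {n : ℕ} → Graph n → Set
Connected G = ConnectedOn G Everything

InducedP3P2 : {n : ℕ} → Graph n → (a b c d e : Fin n) → Set
InducedP3P2 G a b c d e =
  (a ≢ b) × (a ≢ c) × (a ≢ d) × (a ≢ e) × (b ≢ c) × (b ≢ d) × (b ≢ e)
  × (c ≢ d) × (c ≢ e) × (d ≢ e)
  × Adj G a b × Adj G b c × Adj G d e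
  × ¬ Adj G a c
  × ¬ Adj G a d × ¬ Adj G a e × ¬ Adj G b d × ¬ Adj G b e
  × ¬ Adj G c d × ¬ Adj G c e

P3P2Free : {n : ℕ} → Graph n → Set
P3P2Free G = ∀ a b c d e → ¬ InducedP3P2 G a b c d e

Axy : {n : ℕ} → Graph n → Fin n → Fin n → VSet n
Axy G x y v = (v ≢ x) × (v ≢ y) × (Adj G x v ⊎ Adj G y v)

Bxy : {n : ℕ} → Graph n → Fin n → Fin n → VSet n
Bxy G x y v = (v ≢ x) × (v ≢ y) × ¬ (Adj G x v ⊎ Adj G y v)

InH : {n : ℕ} → Graph n → Fin n → Fin n → Fin n → VSet n
InH G x y z v = ¬ ((v ≡ z) ⊎ (Adj G z v × Bxy G x y v))

Aset : {n : ℕ} → Graph n → Fin n → Fin n → Fin n → VSet n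
Aset G x y z v = Axy G x y v × (v ≢ z)

Bset : {n : ℕ} → Graph n → Fin n → Fin n → Fin n → VSet n
Bset G x y z v = Bxy G x y v × ¬ Adj G z v

NH : {n : ℕ} → Graph n → VSet n → Fin n → VSet n
NH G S v w = S w × Adj G v w

DegreeOneIn : {n : ℕ} → Graph n → VSet n → Fin n → Set
DegreeOneIn G S v = Σ _ λ w → NH G S v w × (∀ w' → NH G S v w' → w' ≡ w)

Independent : {n : ℕ} → Graph n → VSet n → Set
Independent G S = ∀ u v → S u → S v → ¬ Adj G u v

_⊆_ : {n : ℕ} → VSet n → VSet n → Set
P ⊆ Q = ∀ v → P v → Q v

module Submission where

-- Let u ∈ N_H(x) ∖ ({y} ∪ N_H(y)) and w ∈ N_H(y) ∖ {x};
-- both lie in A.  For a vertex v write P(v) = N_H(v) ∖ (A ∪ {x,y}) for its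
-- "private" neighbourhood; every private neighbour lies in the independent
-- set B, hence is neither y nor adjacent to y.  Suppose u and w were not
-- adjacent.  If s ∈ P(w) misses u and t ∈ P(u) missed w, then s-w-y together
-- with u-t would be an induced P3+P2.  Hence the private neighbourhoods of u
-- and w are nested: P(u) ⊄ P(w) forces P(w) ⊆ P(u).  Both inclusions are
-- excluded by hypothesis, a contradiction; adjacency being decidable, u ~ w.

open import Defs
open import Data.Nat using (ℕ)
open import Data.Fin using (Fin)
open import Data.Product using (Σ; _×_; _,_; proj₁; proj₂)
open import Data.Sum using (_⊎_; inj₁; inj₂)
open import Data.Empty using (⊥; ⊥-elim)
open import Relation.Nullary using (¬_; yes; no)
open import Relation.Binary.PropositionalEquality using (_≡_; _≢_; refl)
import Relation.Binary.PropositionalEquality as Eq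

module _ {n : ℕ} (G : Graph n) where

  adj⇒≢ : ∀ {a b} → Adj G a b → a ≢ b
  adj⇒≢ ab refl = irrefl G ab

  separated⇒≢ : ∀ {a b c} → Adj G a c → ¬ Adj G b c → a ≢ b
  separated⇒≢ ac ¬bc refl = ¬bc ac

  -- An induced P3+P2 a-b-c, d-e is determined by its three edges, its seven
  -- non-edges and a ≢ c: all other distinctness conditions follow.
  no-induced-P3+P2 : P3P2Free G → ∀ {a b c d e} →
    Adj G a b → Adj G b c → Adj G d e → a ≢ c →
    ¬ Adj G a c → ¬ Adj G a d → ¬ Adj G a e → ¬ Adj G b d → ¬ Adj G b e →
    ¬ Adj G c d → ¬ Adj G c e → ⊥
  no-induced-P3+P2 free {a} {b} {c} {d} {e} ab bc de a≢c ¬ac ¬ad ¬ae ¬bd ¬be ¬cd ¬ce =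
    free a b c d e
      ( adj⇒≢ ab , a≢c , separated⇒≢ ab (flip ¬bd) , separated⇒≢ ab (flip ¬be)
      , adj⇒≢ bc , separated⇒≢ (sym G ab) (flip ¬ad) , separated⇒≢ (sym G ab) (flip ¬ae)
      , separated⇒≢ (sym G bc) (flip ¬bd) , separated⇒≢ (sym G bc) (flip ¬be) , adj⇒≢ de
      , ab , bc , de
      , ¬ac , ¬ad , ¬ae , ¬bd , ¬be , ¬cd , ¬ce )
    where
    flip : ∀ {p q} → ¬ Adj G p q → ¬ Adj G q p
    flip ¬pq qp = ¬pq (sym G qp)

  Private : VSet n → VSet n → Fin n → VSet n
  Private S X v b = NH G S v b × ¬ X b

  -- For non-adjacent u, w with w ~ y and u ≁ y, the private
  -- neighbourhoods of u and w are nested: if P(u) ⊄ P(w), then P(w) ⊆ P(u).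
  -- (Otherwise s ∈ P(w) ∖ N(u) and t ∈ P(u) ∖ N(w) give the induced P3+P2
  -- s-w-y, u-t.)
  private-nested : P3P2Free G → (S X Q : VSet n) (y u w : Fin n) →
    Independent G Q → (∀ b → Q b → b ≢ y × ¬ Adj G y b) →
    (∀ v b → Private S X v b → Q b) →
    Adj G w y → ¬ Adj G u y → ¬ Adj G u w →
    ¬ (Private S X u ⊆ Private S X w) → Private S X w ⊆ Private S X u
  private-nested free S X Q y u w indep Q-far-from-y private⊆Q wy ¬uy ¬uw P[u]⊈P[w]
    s ((Ss , ws) , ¬Xs) with adj? G u s
  ... | yes us = (Ss , us) , ¬Xs
  ... | no ¬us = ⊥-elim (P[u]⊈P[w] P[u]⊆P[w])
    where
    Qs : Q s
    Qs = private⊆Q w s ((Ss , ws) , ¬Xs)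

    P[u]⊆P[w] : Private S X u ⊆ Private S X w
    P[u]⊆P[w] t ((St , ut) , ¬Xt) with adj? G w t
    ... | yes wt = (St , wt) , ¬Xt
    ... | no ¬wt = ⊥-elim
      (no-induced-P3+P2 free (sym G ws) wy ut (proj₁ (Q-far-from-y s Qs))
        (λ sy → proj₂ (Q-far-from-y s Qs) (sym G sy))
        (λ su → ¬us (sym G su)) (indep s t Qs Qt)
        (λ wu → ¬uw (sym G wu)) ¬wt
        (λ yu → ¬uy (sym G yu)) (proj₂ (Q-far-from-y t Qt)))
      where
      Qt : Q t
      Qt = private⊆Q u t ((St , ut) , ¬Xt)

module _ {n : ℕ} (G : Graph n) (x y z : Fin n) where

  Core : VSet n
  Core w = Aset G x y z w ⊎ (w ≡ x ⊎ w ≡ y)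

  H∖Core⊆B : ∀ v → InH G x y z v → ¬ Core v → Bset G x y z v
  H∖Core⊆B v Hv ¬Core = Bv , λ zv → Hv (inj₂ (zv , Bv))
    where
    v≢x : v ≢ x
    v≢x e = ¬Core (inj₂ (inj₁ e))
    v≢y : v ≢ y
    v≢y e = ¬Core (inj₂ (inj₂ e))
    Bv : Bxy G x y v
    Bv = v≢x , v≢y , λ xy-v → ¬Core (inj₁ ((v≢x , v≢y , xy-v) , λ e → Hv (inj₁ e)))

  B-far-from-y : ∀ b → Bset G x y z b → b ≢ y × ¬ Adj G y b
  B-far-from-y b ((_ , b≢y , ¬xy-b) , _) = b≢y , λ yb → ¬xy-b (inj₂ yb)

  x-neighbour∈A : ∀ {u} → NH G (InH G x y z) x u → u ≢ y → Aset G x y z u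
  x-neighbour∈A (Hu , xu) u≢y =
    ((λ e → adj⇒≢ G xu (Eq.sym e)) , u≢y , inj₁ xu) , λ e → Hu (inj₁ e)

  y-neighbour∈A : ∀ {w} → NH G (InH G x y z) y w → w ≢ x → Aset G x y z w
  y-neighbour∈A (Hw , yw) w≢x =
    (w≢x , (λ e → adj⇒≢ G yw (Eq.sym e)) , inj₂ yw) , λ e → Hw (inj₁ e)

lemma3 : {n : ℕ} (G : Graph n) (x y z : Fin n) →
    Connected G → P3P2Free G → Adj G x y →
    Axy G x y z →
    Σ (Fin n) (λ b → Bxy G x y b × Adj G z b) →
    Independent G (Bset G x y z) →
    ConnectedOn G (InH G x y z) →
    Σ (Fin n) (Aset G x y z) →
    Σ (Fin n) (Bset G x y z) →
    (∀ a → Aset G x y z a → Σ (Fin n) (λ b → Bset G x y z b × Adj G a b)) →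
    (∀ b → Bset G x y z b → ¬ DegreeOneIn G (InH G x y z) b) →
    (∀ u v → Aset G x y z u → Aset G x y z v → u ≢ v →
      ¬ ((λ w → NH G (InH G x y z) u w × ¬ (Aset G x y z w ⊎ (w ≡ x ⊎ w ≡ y)))
         ⊆ (λ w → NH G (InH G x y z) v w × ¬ (Aset G x y z w ⊎ (w ≡ x ⊎ w ≡ y))))) →
    ∀ u w →
      NH G (InH G x y z) x u → u ≢ y → ¬ NH G (InH G x y z) y u →
      NH G (InH G x y z) y w → w ≢ x →
      Adj G u w
lemma3 {n} G x y z _ free _ _ _ indep _ _ _ _ _ incomparable u w x~u u≢y ¬y~u y~w w≢x
  with adj? G u w
... | yes uw = uw
... | no ¬uw = ⊥-elim
  (incomparable w u A[w] A[u] w≢u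
    (private-nested G free H (Core G x y z) (Bset G x y z) y u w indep
      (B-far-from-y G x y z) private⊆B (sym G (proj₂ y~w)) ¬uy ¬uw
      (incomparable u w A[u] A[w] (λ e → w≢u (Eq.sym e)))))
  where
  H : VSet n
  H = InH G x y z

  A[u] : Aset G x y z u
  A[u] = x-neighbour∈A G x y z x~u u≢y

  A[w] : Aset G x y z w
  A[w] = y-neighbour∈A G x y z y~w w≢x

  ¬uy : ¬ Adj G u y
  ¬uy uy = ¬y~u (proj₁ x~u , sym G uy)

  w≢u : w ≢ u
  w≢u = separated⇒≢ G (sym G (proj₂ y~w)) ¬uy

  private⊆B : ∀ v b → Private G H (Core G x y z) v b → Bset G x y z b
  private⊆B v b ((Hb , _) , ¬Core) = H∖Core⊆B G x y z b Hb ¬Core
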